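{- Let $G$ be a finite simple graph with a $1$-factor $F$ such that $G$ has an odd $F$-set. Then $G$ cannot have both an odd $F$-orientation and an even $F$-orientation.
   Context: A cycle $C$ of $G$ is $F$-alternating if $|E(C)|=2|E(F)\cap E(C)|$. An even cycle $C$ in an orientation of $G$ is evenly (resp. oddly) oriented if, for either direction of traversal around $C$, the number of edges of $C$ directed along the traversal is even (resp. odd). An orientation of $G$ is an even (resp. odd) $F$-orientation if every $F$-alternating cycle is evenly (resp. oddly) oriented. A zero-sum $F$-set is a finite family $\{C_1,\ldots,C_k\}$ of $F$-alternating cycles such that every edge of $G$ lies in an even number of its members; it is an odd $F$-set if $k$ is odd. -}

module Defs where

open import Data.Nat using (ℕ; zero; suc; _+_; _*_; _%_; _≤_)
open import Data.Nat.DivMod using (m%n<n)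
open import Data.Fin using (Fin; toℕ; fromℕ<; _≟_)
open import Data.Bool using (Bool; true; false; _∧_; _∨_; not; if_then_else_)
open import Data.List using (List; length; filter)
open import Data.Product using (Σ; ∃; _×_; _,_)
open import Function using (_∘_)
open import Function.Definitions using (Injective)
open import Relation.Binary.PropositionalEquality using (_≡_)
open import Relation.Nullary.Decidable using (⌊_⌋; does)
open import Data.Empty using (⊥)

Even : ℕ → Set
Even k = k % 2 ≡ 0

Odd : ℕ → Set
Odd k = k % 2 ≡ 1

countF : ∀ {m} → (Fin m → Bool) → ℕ
countF {zero}  f = 0
countF {suc m} f = (if f Fin.zero then 1 else 0) + countF (f ∘ Fin.suc)

anyF : ∀ {m} → (Fin m → Bool) → Bool
anyF {zero}  f = false
anyF {suc m} f = f Fin.zero ∨ anyF (f ∘ Fin.suc)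

nxt : ∀ {m} → Fin (suc m) → Fin (suc m)
nxt {m} i = fromℕ< (m%n<n (suc (toℕ i)) (suc m))

record Graph (n : ℕ) : Set where
  field
    adj    : Fin n → Fin n → Bool
    sym    : ∀ u v → adj u v ≡ adj v u
    irrefl : ∀ u → adj u u ≡ false
open Graph public

record OneFactor {n : ℕ} (G : Graph n) : Set where
  field
    inF    : Fin n → Fin n → Bool
    sub    : ∀ u v → inF u v ≡ true → adj G u v ≡ true
    symF   : ∀ u v → inF u v ≡ inF v u
    unique : ∀ u → Σ (Fin n) λ v → (inF u v ≡ true) × (∀ w → inF u w ≡ true → w ≡ v)
open OneFactor public

-- A cycle of G: cyclic sequence v_0,…,v_{m-1} of m ≥ 3 distinct vertices,
-- consecutive ones (including v_{m-1}v_0) adjacent.  len = m - 1.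
record Cycle {n : ℕ} (G : Graph n) : Set where
  field
    len    : ℕ
    long   : 2 ≤ len
    vert   : Fin (suc len) → Fin n
    inj    : Injective _≡_ _≡_ vert
    edges  : ∀ i → adj G (vert i) (vert (nxt i)) ≡ true
open Cycle public

size : ∀ {n} {G : Graph n} → Cycle G → ℕ
size C = suc (len C)

fEdges : ∀ {n} {G : Graph n} → OneFactor G → Cycle G → ℕ
fEdges F C = countF λ i → inF F (vert C i) (vert C (nxt i))

Alternating : ∀ {n} {G : Graph n} → OneFactor G → Cycle G → Set
Alternating F C = size C ≡ 2 * fEdges F C

-- An orientation of G: each edge uv gets exactly one direction.
-- dir u v ≡ true means the edge is directed u → v.
record Orientation {n : ℕ} (G : Graph n) : Set where
  field
    dir      : Fin n → Fin n → Bool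
    dirEdge  : ∀ u v → dir u v ≡ true → adj G u v ≡ true
    exactly1 : ∀ u v → adj G u v ≡ true → dir u v ≡ not (dir v u)
open Orientation public

forwardCount : ∀ {n} {G : Graph n} → Orientation G → Cycle G → ℕ
forwardCount D C = countF λ i → dir D (vert C i) (vert C (nxt i))

backwardCount : ∀ {n} {G : Graph n} → Orientation G → Cycle G → ℕ
backwardCount D C = countF λ i → dir D (vert C (nxt i)) (vert C i)

EvenlyOriented : ∀ {n} {G : Graph n} → Orientation G → Cycle G → Set
EvenlyOriented D C = Even (forwardCount D C) × Even (backwardCount D C)

OddlyOriented : ∀ {n} {G : Graph n} → Orientation G → Cycle G → Set
OddlyOriented D C = Odd (forwardCount D C) × Odd (backwardCount D C)

EvenFOrientation : ∀ {n} {G : Graph n} → OneFactor G → Orientation G → Set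
EvenFOrientation F D = ∀ C → Alternating F C → EvenlyOriented D C

OddFOrientation : ∀ {n} {G : Graph n} → OneFactor G → Orientation G → Set
OddFOrientation F D = ∀ C → Alternating F C → OddlyOriented D C

hasEdge : ∀ {n} {G : Graph n} → Cycle G → Fin n → Fin n → Bool
hasEdge C u w = anyF λ i →
  (does (vert C i ≟ u) ∧ does (vert C (nxt i) ≟ w)) ∨
  (does (vert C i ≟ w) ∧ does (vert C (nxt i) ≟ u))

data AllAlt {n : ℕ} {G : Graph n} (F : OneFactor G) : List (Cycle G) → Set where
  []  : AllAlt F List.[]
  _∷_ : ∀ {C Cs} → Alternating F C → AllAlt F Cs → AllAlt F (C List.∷ Cs)

multiplicity : ∀ {n} {G : Graph n} → List (Cycle G) → Fin n → Fin n → ℕ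
multiplicity List.[] u w = 0
multiplicity (C List.∷ Cs) u w = (if hasEdge C u w then 1 else 0) + multiplicity Cs u w

ZeroSumFSet : ∀ {n} {G : Graph n} → OneFactor G → List (Cycle G) → Set
ZeroSumFSet {G = G} F Cs = AllAlt F Cs × (∀ u w → adj G u w ≡ true → Even (multiplicity Cs u w))

OddFSet : ∀ {n} {G : Graph n} → OneFactor G → List (Cycle G) → Set
OddFSet F Cs = ZeroSumFSet F Cs × Odd (length Cs)

HasOddFSet : ∀ {n} {G : Graph n} → OneFactor G → Set
HasOddFSet {G = G} F = Σ (List (Cycle G)) (OddFSet F)

-- Let D₁ be an odd and D₂ an even F-orientation, and let S be the set of edges on
-- which they disagree.  Along any cycle the forward counts of D₁ and D₂ differ in
-- parity by |E(C) ∩ S|, so every F-alternating cycle meets S in an odd number of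
-- edges.  Summing |E(C) ∩ S| mod 2 over an odd F-set gives 1 (odd many odd terms),
-- but also 0, since every edge of S lies in an even number of its members.
module Submission where

open import Defs
open import Algebra.Bundles using (CommutativeRing)
open import Data.Bool using (Bool; true; false; not; _∧_; _∨_; _xor_; if_then_else_)
open import Data.Bool.Properties
  using (xor-∧-commutativeRing; not-distribˡ-xor; xor-identityʳ; ∧-comm; ∧-assoc; ∧-zeroʳ; ∧-identityʳ;
         ∧-distribʳ-xor)
open import Data.Empty using (⊥; ⊥-elim)
open import Data.Fin using (Fin; zero; suc; toℕ; _≟_)
open import Data.Fin.Properties using (toℕ-fromℕ<; toℕ≤pred[n]) renaming (suc-injective to Fin-suc-injective)
open import Data.List using (List; []; _∷_; length; lookup)
open import Data.Nat using (ℕ; zero; suc; _+_; _%_; _≤_; _<_; s≤s)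
open import Data.Nat.DivMod using (m<n⇒m%n≡m; n%n≡0)
open import Data.Nat.Properties using (m≤n⇒m<n∨m≡n; m≢1+n+m; <⇒≤)
open import Data.Product using (Σ; _×_; _,_; proj₁)
open import Data.Sum as Sum using (_⊎_; inj₁; inj₂)
open import Function using (_∘_)
open import Relation.Binary.PropositionalEquality as ≡
  using (_≡_; _≢_; refl; trans; cong; cong₂; module ≡-Reasoning)
open import Relation.Nullary using (¬_; yes; no; does; contradiction)

-- Sums ∑ are taken in the field (Bool, xor, ∧) with two elements.
open import Algebra.Properties.Semiring.Sum (CommutativeRing.semiring xor-∧-commutativeRing)
  using (sum-syntax; ∑-comm; ∑-distrib-+; *-distribˡ-sum; *-distribʳ-sum;
         sum-cong-≗; sum-replicate-zero)

oddᵇ : ℕ → Bool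
oddᵇ zero    = false
oddᵇ (suc n) = not (oddᵇ n)

oddᵇ-+ : ∀ m n → oddᵇ (m + n) ≡ oddᵇ m xor oddᵇ n
oddᵇ-+ zero    n = refl
oddᵇ-+ (suc m) n = trans (cong not (oddᵇ-+ m n)) (not-distribˡ-xor (oddᵇ m) (oddᵇ n))

oddᵇ-indicator : ∀ b → oddᵇ (if b then 1 else 0) ≡ b
oddᵇ-indicator true  = refl
oddᵇ-indicator false = refl

%2≡if-oddᵇ : ∀ n → n % 2 ≡ (if oddᵇ n then 1 else 0)
%2≡if-oddᵇ 0 = refl
%2≡if-oddᵇ 1 = refl
%2≡if-oddᵇ (suc (suc n)) with oddᵇ n | %2≡if-oddᵇ n
... | true  | eq = eq
... | false | eq = eq

Even⇒¬oddᵇ : ∀ n → Even n → oddᵇ n ≡ false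
Even⇒¬oddᵇ n even with oddᵇ n | %2≡if-oddᵇ n
... | false | _     = refl
... | true  | n%2≡1 = contradiction (trans (≡.sym even) n%2≡1) λ ()

Odd⇒oddᵇ : ∀ n → Odd n → oddᵇ n ≡ true
Odd⇒oddᵇ n odd with oddᵇ n | %2≡if-oddᵇ n
... | true  | _     = refl
... | false | n%2≡0 = contradiction (trans (≡.sym odd) n%2≡0) λ ()

oddᵇ-countF : ∀ {m} (f : Fin m → Bool) → oddᵇ (countF f) ≡ ∑[ i < m ] f i
oddᵇ-countF {zero}  f = refl
oddᵇ-countF {suc m} f = trans (oddᵇ-+ (if f zero then 1 else 0) _)
  (cong₂ _xor_ (oddᵇ-indicator (f zero)) (oddᵇ-countF (f ∘ suc)))

∑-true : ∀ m → ∑[ i < m ] true ≡ oddᵇ m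
∑-true zero    = refl
∑-true (suc m) = cong not (∑-true m)

∑-false : ∀ {m} (f : Fin m → Bool) → (∀ i → f i ≡ false) → ∑[ i < m ] f i ≡ false
∑-false {m} f f≡false = trans (sum-cong-≗ f≡false) (sum-replicate-zero m)

∑-sift : ∀ {n} (x : Fin n) (k : Fin n → Bool) → ∑[ a < n ] (does (x ≟ a) ∧ k a) ≡ k x
∑-sift {suc n} zero    k = trans (cong (k zero xor_) (sum-replicate-zero n)) (xor-identityʳ (k zero))
∑-sift {suc n} (suc x) k = ∑-sift x (k ∘ suc)

∑∑-sift : ∀ {n} (x y : Fin n) (g : Fin n → Fin n → Bool) →
          ∑[ u < n ] ∑[ w < n ] ((does (x ≟ u) ∧ does (y ≟ w)) ∧ g u w) ≡ g x y
∑∑-sift {n} x y g = begin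
  ∑[ u < n ] ∑[ w < n ] ((does (x ≟ u) ∧ does (y ≟ w)) ∧ g u w)
    ≡⟨ sum-cong-≗ (λ u → sum-cong-≗ (λ w → ∧-assoc (does (x ≟ u)) (does (y ≟ w)) (g u w))) ⟩
  ∑[ u < n ] ∑[ w < n ] (does (x ≟ u) ∧ (does (y ≟ w) ∧ g u w))
    ≡⟨ sum-cong-≗ (λ u → *-distribˡ-sum (does (x ≟ u)) (λ w → does (y ≟ w) ∧ g u w)) ⟨
  ∑[ u < n ] (does (x ≟ u) ∧ ∑[ w < n ] (does (y ≟ w) ∧ g u w))
    ≡⟨ sum-cong-≗ (λ u → cong (does (x ≟ u) ∧_) (∑-sift y (g u))) ⟩
  ∑[ u < n ] (does (x ≟ u) ∧ g u y)
    ≡⟨ ∑-sift x (λ u → g u y) ⟩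
  g x y ∎
  where open ≡-Reasoning

anyF≡∑ : ∀ {m} (f : Fin m → Bool) → (∀ i j → f i ≡ true → f j ≡ true → i ≡ j) →
         anyF f ≡ ∑[ i < m ] f i
anyF≡∑ {zero}  f unique = refl
anyF≡∑ {suc m} f unique with f zero in f₀
... | true  = cong not (≡.sym (∑-false (f ∘ suc) tail≡false))
  where
  tail≡false : ∀ i → f (suc i) ≡ false
  tail≡false i with f (suc i) in fᵢ
  ... | true  = contradiction (unique zero (suc i) f₀ fᵢ) λ ()
  ... | false = refl
... | false = anyF≡∑ (f ∘ suc) λ i j fᵢ fⱼ → Fin-suc-injective (unique (suc i) (suc j) fᵢ fⱼ)

∨≡xor : ∀ {a b} → (a ≡ true → b ≡ true → ⊥) → a ∨ b ≡ a xor b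
∨≡xor {true}  {true}  exclusive = contradiction refl (exclusive refl)
∨≡xor {true}  {false} exclusive = refl
∨≡xor {false}         exclusive = refl

∧-true : ∀ {a b} → a ∧ b ≡ true → a ≡ true × b ≡ true
∧-true {true} {true} _ = refl , refl

∨-true : ∀ {a b} → a ∨ b ≡ true → a ≡ true ⊎ b ≡ true
∨-true {true}  _ = inj₁ refl
∨-true {false} b = inj₂ b

toℕ-nxt : ∀ {m} (i : Fin (suc m)) →
          (toℕ i < m × toℕ (nxt i) ≡ suc (toℕ i)) ⊎ (toℕ i ≡ m × toℕ (nxt i) ≡ 0)
toℕ-nxt {m} i with m≤n⇒m<n∨m≡n (toℕ≤pred[n] i)
... | inj₁ i<m = inj₁ (i<m , trans (toℕ-fromℕ< _) (m<n⇒m%n≡m (s≤s i<m)))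
... | inj₂ i≡m = inj₂ (i≡m , trans (toℕ-fromℕ< _) (trans (cong (λ k → suc k % suc m) i≡m) (n%n≡0 (suc m))))

nxt≢id : ∀ {m} → 1 ≤ m → (i : Fin (suc m)) → nxt i ≢ i
nxt≢id (s≤s _) i eq with toℕ-nxt i | cong toℕ eq
... | inj₁ (_ , i⁺) | e = m≢1+n+m (toℕ i) {0} (≡.sym (trans (≡.sym i⁺) e))
... | inj₂ (i≡m , i⁺) | e = contradiction (trans (≡.sym i⁺) (trans e i≡m)) λ ()

nxt∘nxt≢id : ∀ {m} → 2 ≤ m → (i : Fin (suc m)) → nxt (nxt i) ≢ i
nxt∘nxt≢id (s≤s (s≤s _)) i eq with toℕ-nxt i | toℕ-nxt (nxt i) | cong toℕ eq
... | inj₁ (_ , i⁺) | inj₁ (_ , i⁺⁺) | e =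
  m≢1+n+m (toℕ i) {1} (≡.sym (trans (≡.sym (trans i⁺⁺ (cong suc i⁺))) e))
... | inj₁ (_ , i⁺) | inj₂ (i⁺≡m , i⁺⁺) | e =
  contradiction (trans (cong suc (trans (≡.sym i⁺⁺) e)) (trans (≡.sym i⁺) i⁺≡m)) λ ()
... | inj₂ (i≡m , i⁺) | inj₁ (_ , i⁺⁺) | e =
  contradiction (trans (≡.sym (trans i⁺⁺ (cong suc i⁺))) (trans e i≡m)) λ ()
... | inj₂ (_ , i⁺) | inj₂ (i⁺≡m , _) | e = contradiction (trans (≡.sym i⁺) i⁺≡m) λ ()

module _ {n : ℕ} {G : Graph n} where

  isStep : (C : Cycle G) → Fin (size C) → Fin n → Fin n → Bool
  isStep C i u w = does (vert C i ≟ u) ∧ does (vert C (nxt i) ≟ w)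

  isStep-sound : (C : Cycle G) {i : Fin (size C)} {u w : Fin n} →
                 isStep C i u w ≡ true → vert C i ≡ u × vert C (nxt i) ≡ w
  isStep-sound C {i} {u} {w} step with vert C i ≟ u | vert C (nxt i) ≟ w
  ... | yes i↦u | yes i⁺↦w = i↦u , i⁺↦w
  isStep-sound C () | yes _ | no _
  isStep-sound C () | no _  | _

  hasEdge≡∑ : (C : Cycle G) (u w : Fin n) →
              hasEdge C u w ≡ ∑[ i < size C ] (isStep C i u w xor isStep C i w u)
  hasEdge≡∑ C u w = trans (anyF≡∑ _ at-most-one) (sum-cong-≗ λ i → ∨≡xor (not-both i))
    where
    v = vert C

    not-both : ∀ i → isStep C i u w ≡ true → isStep C i w u ≡ true → ⊥
    not-both i uw wu with isStep-sound C uw | isStep-sound C wu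
    ... | _ , i⁺↦w | i↦w , _ = nxt≢id (<⇒≤ (long C)) i (inj C (trans i⁺↦w (≡.sym i↦w)))

    crossing : ∀ i j → v i ≡ v (nxt j) → v (nxt i) ≡ v j → ⊥
    crossing i j i↦j⁺ i⁺↦j =
      nxt∘nxt≢id (long C) j (trans (cong nxt (≡.sym (inj C i↦j⁺))) (inj C i⁺↦j))

    ends : ∀ {i} → (isStep C i u w ∨ isStep C i w u) ≡ true →
           (v i ≡ u × v (nxt i) ≡ w) ⊎ (v i ≡ w × v (nxt i) ≡ u)
    ends s = Sum.map (isStep-sound C) (isStep-sound C) (∨-true s)

    at-most-one : ∀ i j → (isStep C i u w ∨ isStep C i w u) ≡ true →
                  (isStep C j u w ∨ isStep C j w u) ≡ true → i ≡ j
    at-most-one i j sᵢ sⱼ with ends sᵢ | ends sⱼ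
    ... | inj₁ (i↦u , _) | inj₁ (j↦u , _) = inj C (trans i↦u (≡.sym j↦u))
    ... | inj₂ (i↦w , _) | inj₂ (j↦w , _) = inj C (trans i↦w (≡.sym j↦w))
    ... | inj₁ (i↦u , i⁺↦w) | inj₂ (j↦w , j⁺↦u) =
      ⊥-elim (crossing i j (trans i↦u (≡.sym j⁺↦u)) (trans i⁺↦w (≡.sym j↦w)))
    ... | inj₂ (i↦w , i⁺↦u) | inj₁ (j↦u , j⁺↦w) =
      ⊥-elim (crossing i j (trans i↦w (≡.sym j⁺↦w)) (trans i⁺↦u (≡.sym j↦u)))

  -- For a set S of ordered pairs containing each edge in at most one direction,
  -- meetParity C S is |E(C) ∩ S| mod 2.
  meetParity : Cycle G → (Fin n → Fin n → Bool) → Bool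
  meetParity C S = ∑[ u < n ] ∑[ w < n ] (hasEdge C u w ∧ S u w)

  meetParity≡∑-along : (C : Cycle G) (S : Fin n → Fin n → Bool) →
    meetParity C S ≡ ∑[ i < size C ] (S (vert C i) (vert C (nxt i)) xor S (vert C (nxt i)) (vert C i))
  meetParity≡∑-along C S = begin
    ∑[ u < n ] ∑[ w < n ] (hasEdge C u w ∧ S u w)
      ≡⟨ sum-cong-≗ (λ u → sum-cong-≗ (λ w → cong (_∧ S u w) (hasEdge≡∑ C u w))) ⟩
    ∑[ u < n ] ∑[ w < n ] (∑[ i < size C ] stepᵢ i u w ∧ S u w)
      ≡⟨ sum-cong-≗ (λ u → sum-cong-≗ (λ w → *-distribʳ-sum (S u w) (λ i → stepᵢ i u w))) ⟩
    ∑[ u < n ] ∑[ w < n ] ∑[ i < size C ] (stepᵢ i u w ∧ S u w)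
      ≡⟨ sum-cong-≗ (λ u → ∑-comm (λ w i → stepᵢ i u w ∧ S u w)) ⟩
    ∑[ u < n ] ∑[ i < size C ] ∑[ w < n ] (stepᵢ i u w ∧ S u w)
      ≡⟨ ∑-comm (λ u i → ∑[ w < n ] (stepᵢ i u w ∧ S u w)) ⟩
    ∑[ i < size C ] ∑[ u < n ] ∑[ w < n ] (stepᵢ i u w ∧ S u w)
      ≡⟨ sum-cong-≗ sift ⟩
    ∑[ i < size C ] (S (v i) (v (nxt i)) xor S (v (nxt i)) (v i)) ∎
    where
    open ≡-Reasoning
    v = vert C

    stepᵢ : Fin (size C) → Fin n → Fin n → Bool
    stepᵢ i u w = isStep C i u w xor isStep C i w u

    sift : ∀ i → ∑[ u < n ] ∑[ w < n ] (stepᵢ i u w ∧ S u w) ≡ S (v i) (v (nxt i)) xor S (v (nxt i)) (v i)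
    sift i = begin
      ∑[ u < n ] ∑[ w < n ] (stepᵢ i u w ∧ S u w)
        ≡⟨ sum-cong-≗ (λ u → trans (sum-cong-≗ (λ w → ∧-distribʳ-xor (S u w) (isStep C i u w) _))
                                    (∑-distrib-+ (λ w → isStep C i u w ∧ S u w) _)) ⟩
      ∑[ u < n ] (∑[ w < n ] (isStep C i u w ∧ S u w) xor ∑[ w < n ] (isStep C i w u ∧ S u w))
        ≡⟨ ∑-distrib-+ (λ u → ∑[ w < n ] (isStep C i u w ∧ S u w)) _ ⟩
      ∑[ u < n ] ∑[ w < n ] (isStep C i u w ∧ S u w) xor ∑[ u < n ] ∑[ w < n ] (isStep C i w u ∧ S u w)
        ≡⟨ cong₂ _xor_ (∑∑-sift (v i) (v (nxt i)) S)
             (trans (sum-cong-≗ (λ u → sum-cong-≗ (λ w → cong (_∧ S u w) (∧-comm (does (v i ≟ w)) _))))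
                    (∑∑-sift (v (nxt i)) (v i) S)) ⟩
      S (v i) (v (nxt i)) xor S (v (nxt i)) (v i) ∎

  disagree : Orientation G → Orientation G → Fin n → Fin n → Bool
  disagree D₁ D₂ u w = dir D₁ u w ∧ not (dir D₂ u w)

  disagree⇒adj : (D₁ D₂ : Orientation G) (u w : Fin n) →
                 disagree D₁ D₂ u w ≡ true → adj G u w ≡ true
  disagree⇒adj D₁ D₂ u w d = dirEdge D₁ u w (proj₁ (∧-true d))

  xor-dir≡disagree : (D₁ D₂ : Orientation G) {u w : Fin n} → adj G u w ≡ true →
    dir D₁ u w xor dir D₂ u w ≡ disagree D₁ D₂ u w xor disagree D₁ D₂ w u
  xor-dir≡disagree D₁ D₂ {u} {w} uw
    rewrite exactly1 D₁ w u (trans (sym G w u) uw) | exactly1 D₂ w u (trans (sym G w u) uw)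
    = split (dir D₁ u w) (dir D₂ u w)
    where
    split : ∀ a b → a xor b ≡ (a ∧ not b) xor (not a ∧ not (not b))
    split true  true  = refl
    split true  false = refl
    split false true  = refl
    split false false = refl

  oddᵇ-forward-xor : (D₁ D₂ : Orientation G) (C : Cycle G) →
    oddᵇ (forwardCount D₁ C) xor oddᵇ (forwardCount D₂ C) ≡ meetParity C (disagree D₁ D₂)
  oddᵇ-forward-xor D₁ D₂ C = begin
    oddᵇ (forwardCount D₁ C) xor oddᵇ (forwardCount D₂ C)
      ≡⟨ cong₂ _xor_ (oddᵇ-countF (λ i → dir D₁ (v i) (v (nxt i))))
                     (oddᵇ-countF (λ i → dir D₂ (v i) (v (nxt i)))) ⟩
    ∑[ i < size C ] dir D₁ (v i) (v (nxt i)) xor ∑[ i < size C ] dir D₂ (v i) (v (nxt i))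
      ≡⟨ ∑-distrib-+ (λ i → dir D₁ (v i) (v (nxt i))) (λ i → dir D₂ (v i) (v (nxt i))) ⟨
    ∑[ i < size C ] (dir D₁ (v i) (v (nxt i)) xor dir D₂ (v i) (v (nxt i)))
      ≡⟨ sum-cong-≗ (λ i → xor-dir≡disagree D₁ D₂ (edges C i)) ⟩
    ∑[ i < size C ] (S (v i) (v (nxt i)) xor S (v (nxt i)) (v i))
      ≡⟨ meetParity≡∑-along C S ⟨
    meetParity C S ∎
    where
    open ≡-Reasoning
    v = vert C
    S = disagree D₁ D₂

  oddᵇ-multiplicity : (Cs : List (Cycle G)) (u w : Fin n) →
    oddᵇ (multiplicity Cs u w) ≡ ∑[ k < length Cs ] hasEdge (lookup Cs k) u w
  oddᵇ-multiplicity []       u w = refl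
  oddᵇ-multiplicity (C ∷ Cs) u w = trans (oddᵇ-+ (if hasEdge C u w then 1 else 0) _)
    (cong₂ _xor_ (oddᵇ-indicator (hasEdge C u w)) (oddᵇ-multiplicity Cs u w))

  ∑-meetParity-zeroSum : (Cs : List (Cycle G)) →
    (∀ u w → adj G u w ≡ true → Even (multiplicity Cs u w)) →
    (S : Fin n → Fin n → Bool) → (∀ u w → S u w ≡ true → adj G u w ≡ true) →
    ∑[ k < length Cs ] meetParity (lookup Cs k) S ≡ false
  ∑-meetParity-zeroSum Cs even S S⊆E = begin
    ∑[ k < length Cs ] ∑[ u < n ] ∑[ w < n ] (e k u w ∧ S u w)
      ≡⟨ ∑-comm (λ k u → ∑[ w < n ] (e k u w ∧ S u w)) ⟩
    ∑[ u < n ] ∑[ k < length Cs ] ∑[ w < n ] (e k u w ∧ S u w)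
      ≡⟨ sum-cong-≗ (λ u → ∑-comm (λ k w → e k u w ∧ S u w)) ⟩
    ∑[ u < n ] ∑[ w < n ] ∑[ k < length Cs ] (e k u w ∧ S u w)
      ≡⟨ sum-cong-≗ (λ u → sum-cong-≗ (λ w → *-distribʳ-sum (S u w) (λ k → e k u w))) ⟨
    ∑[ u < n ] ∑[ w < n ] (∑[ k < length Cs ] e k u w ∧ S u w)
      ≡⟨ sum-cong-≗ (λ u → sum-cong-≗ (λ w → cong (_∧ S u w) (oddᵇ-multiplicity Cs u w))) ⟨
    ∑[ u < n ] ∑[ w < n ] (oddᵇ (multiplicity Cs u w) ∧ S u w)
      ≡⟨ ∑-false _ (λ u → ∑-false (λ w → oddᵇ (multiplicity Cs u w) ∧ S u w) (vanishes u)) ⟩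
    false ∎
    where
    open ≡-Reasoning
    e : Fin (length Cs) → Fin n → Fin n → Bool
    e k = hasEdge (lookup Cs k)

    vanishes : ∀ u w → oddᵇ (multiplicity Cs u w) ∧ S u w ≡ false
    vanishes u w with S u w in Suw
    ... | false = ∧-zeroʳ _
    ... | true  = trans (∧-identityʳ _) (Even⇒¬oddᵇ (multiplicity Cs u w) (even u w (S⊆E u w Suw)))

  AllAlt-lookup : {F : OneFactor G} {Cs : List (Cycle G)} → AllAlt F Cs →
                  (k : Fin (length Cs)) → Alternating F (lookup Cs k)
  AllAlt-lookup (alt ∷ _)    zero    = alt
  AllAlt-lookup (_   ∷ alts) (suc k) = AllAlt-lookup alts k

corollary2p3 : (n : ℕ) (G : Graph n) (F : OneFactor G) → HasOddFSet F →
    ¬ (Σ (Orientation G) (OddFOrientation F) × Σ (Orientation G) (EvenFOrientation F))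
corollary2p3 n G F (Cs , (alts , even) , oddLength) ((D₁ , oddD₁) , (D₂ , evenD₂)) =
  contradiction (begin
    true
      ≡⟨ Odd⇒oddᵇ (length Cs) oddLength ⟨
    oddᵇ (length Cs)
      ≡⟨ ∑-true (length Cs) ⟨
    ∑[ k < length Cs ] true
      ≡⟨ sum-cong-≗ (λ k → meets-oddly (lookup Cs k) (AllAlt-lookup alts k)) ⟨
    ∑[ k < length Cs ] meetParity (lookup Cs k) (disagree D₁ D₂)
      ≡⟨ ∑-meetParity-zeroSum Cs even (disagree D₁ D₂) (disagree⇒adj D₁ D₂) ⟩
    false ∎) λ ()
  where
  open ≡-Reasoning

  meets-oddly : (C : Cycle G) → Alternating F C → meetParity C (disagree D₁ D₂) ≡ true
  meets-oddly C alt = begin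
    meetParity C (disagree D₁ D₂)
      ≡⟨ oddᵇ-forward-xor D₁ D₂ C ⟨
    oddᵇ (forwardCount D₁ C) xor oddᵇ (forwardCount D₂ C)
      ≡⟨ cong₂ _xor_ (Odd⇒oddᵇ (forwardCount D₁ C) (proj₁ (oddD₁ C alt)))
                     (Even⇒¬oddᵇ (forwardCount D₂ C) (proj₁ (evenD₂ C alt))) ⟩
    true ∎
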